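{- Let $q$ be any prime power. For all $t,t'\in\mathbb F_q^*$, the functions $\frac{X^3+X^2+t}{X}$ and $\frac{X^3+t'}{X}$ are not equivalent.
   Context: $\mathbb F_q$ is the field with $q$ elements. $\mathrm{PGL}(2,\mathbb F_q)$ is the group (under composition) of rational functions $(aX+b)/(cX+d)$, $a,b,c,d\in\mathbb F_q$, $ad-bc\neq0$. Two nonconstant $f,g\in\mathbb F_q(X)$ are equivalent if $g=\psi\circ f\circ\phi$ for some $\psi,\phi\in\mathrm{PGL}(2,\mathbb F_q)$. -}

module Defs where

open import Level using (0ℓ)
open import Data.Nat using (ℕ; zero; suc; _⊔_; _∸_)
open import Data.Fin using (Fin)
open import Data.List using (List; []; _∷_; map; length)
open import Data.Product using (Σ; ∃; _×_; _,_)
open import Relation.Nullary using (¬_)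
open import Relation.Binary.PropositionalEquality using (_≡_)
open import Algebra.Structures using (IsCommutativeRing)
open import Function.Bundles using (_↔_)

-- Every finite field is some F_q with q a prime power, and every F_q arises.
record FiniteField : Set₁ where
  infixl 6 _+_
  infixl 7 _*_
  field
    F      : Set
    _+_    : F → F → F
    _*_    : F → F → F
    -_     : F → F
    0#     : F
    1#     : F
    isCommutativeRing : IsCommutativeRing _≡_ _+_ _*_ -_ 0# 1#
    0≢1    : ¬ (0# ≡ 1#)
    inverse : ∀ x → ¬ (x ≡ 0#) → ∃ λ y → x * y ≡ 1#
    size   : ℕ
    enum   : F ↔ Fin size

module RatFun (K : FiniteField) where
  open FiniteField K

  -- Polynomials in F[X] as coefficient lists, lowest degree first.
  Poly : Set
  Poly = List F

  coeff : Poly → ℕ → F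
  coeff []       _       = 0#
  coeff (a ∷ p)  zero    = a
  coeff (a ∷ p)  (suc n) = coeff p n

  _≈ₚ_ : Poly → Poly → Set
  p ≈ₚ q = ∀ n → coeff p n ≡ coeff q n

  _⊕_ : Poly → Poly → Poly
  []      ⊕ q       = q
  (a ∷ p) ⊕ []      = a ∷ p
  (a ∷ p) ⊕ (b ∷ q) = (a + b) ∷ (p ⊕ q)

  scal : F → Poly → Poly
  scal c p = map (c *_) p

  _⊗_ : Poly → Poly → Poly
  []      ⊗ q = []
  (a ∷ p) ⊗ q = scal a q ⊕ (0# ∷ (p ⊗ q))

  pow : Poly → ℕ → Poly
  pow p zero    = 1# ∷ []
  pow p (suc n) = p ⊗ pow p n

  -- A rational function N/D (denominator D nonzero in all uses below).
  record Rat : Set where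
    constructor _/_
    field
      num : Poly
      den : Poly
  open Rat public

  _≈ᵣ_ : Rat → Rat → Set
  r ≈ᵣ s = (num r ⊗ den s) ≈ₚ (num s ⊗ den r)

  -- elements (aX+b)/(cX+d) of PGL(2,F), ad - bc ≠ 0
  record Mob : Set where
    field
      a b c d : F
      det≢0   : ¬ (a * d + - (b * c) ≡ 0#)
  open Mob public

  postcomp : Mob → Rat → Rat
  postcomp ψ (N / D) = (scal (a ψ) N ⊕ scal (b ψ) D) / (scal (c ψ) N ⊕ scal (d ψ) D)

  -- homog L M p m = Σ_i p_i L^i M^(m-i)   (for m ≥ deg p)
  homog : Poly → Poly → Poly → ℕ → Poly
  homog L M []       m = []
  homog L M (p ∷ ps) m = scal p (pow M m) ⊕ (L ⊗ homog L M ps (m ∸ 1))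

  -- (N/D) ∘ ((aX+b)/(cX+d)) = (N(φ)·(cX+d)^m) / (D(φ)·(cX+d)^m), m ≥ deg N, deg D
  precomp : Rat → Mob → Rat
  precomp (N / D) φ =
    let L = b φ ∷ a φ ∷ []
        M = d φ ∷ c φ ∷ []
        m = length N ⊔ length D
    in homog L M N m / homog L M D m

  Equivalent : Rat → Rat → Set
  Equivalent f g = Σ Mob λ ψ → Σ Mob λ φ → g ≈ᵣ postcomp ψ (precomp f φ)

  fA : F → Rat
  fA t = (t ∷ 0# ∷ 1# ∷ 1# ∷ []) / (0# ∷ 1# ∷ [])

  fB : F → Rat
  fB t = (t ∷ 0# ∷ 0# ∷ 1# ∷ []) / (0# ∷ 1# ∷ [])

-- Write f = (X³ + X² + t)/X and φ = (αX + β)/(γX + δ).  With L = αX + β and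
-- M = γX + δ, precomposition gives f∘φ = N/D where D = L M³ and
-- N = t M⁴ + L² M² + L³ M.  If (X³ + t′)/X = ψ∘f∘φ then
-- (X³ + t′)(cN + dD) = X(aN + bD); as X and X³ + t′ are coprime and N, D have
-- degree at most 4, aN + bD = R(X³ + t′) and cN + dD = RX for some R of degree
-- at most one.  Inverting ψ, N and D lie in R·⟨X, X³ + t′⟩, so both vanish at
-- the root of R, a point of the projective line.  If M does not vanish there,
-- D = L M³ forces L to vanish there, and then N = t M⁴ does not.  If M does
-- vanish there, M is a multiple of R and comparing coefficients is
-- contradictory: for R ∝ X + r it forces β = -2αr and t′ = -2r³, and then
-- (3αγr²)² = 0 although det φ = 3αγr; for constant R it forces γ = β = 0, and
-- then (αδ)² = 0.  (If R = 0, evaluate at the root of L instead.)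

module Submission where

open import Defs
open import Level using (0ℓ)
open import Algebra.Bundles using (CommutativeRing)
open import Algebra.Bundles.Raw using (RawRing)
open import Data.Nat.Base as ℕ using (ℕ; zero; suc; _∸_)
import Data.Nat.Properties as ℕ
open import Data.Integer.Base as ℤ using (ℤ; -[1+_]; _⊖_; 0ℤ; 1ℤ)
import Data.Integer.Properties as ℤ
open import Data.List.Base using (List; []; _∷_; map)
open import Data.Maybe.Base as Maybe using (Maybe)
open import Data.Product.Base using (_×_; _,_)
open import Data.Fin.Properties as Fin using ()
open import Data.Empty using (⊥; ⊥-elim)
open import Function.Base using (_∘_)
open import Function.Properties.Inverse using (↔⇒↣)
open import Relation.Nullary using (¬_)
open import Relation.Nullary.Decidable using (yes; no; via-injection)
open import Relation.Binary.Definitions using (DecidableEquality)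
open import Relation.Binary.Consequences using (dec⇒weaklyDec)
open import Relation.Binary.PropositionalEquality
  using (_≡_; _≢_; refl; sym; trans; cong; cong₂; subst; subst₂; module ≡-Reasoning)
open import Algebra.Solver.Ring.AlmostCommutativeRing
  using (fromCommutativeRing; _-Raw-AlmostCommutative⟶_)

-- Tactic.RingSolver takes its coefficients from the ring itself, so for an
-- abstract field it cannot see that 1# - 1# is zero.  This instance of the
-- ring solver uses integer coefficients through the canonical map ℤ → R.
module IntegerCoefficientSolver {c ℓ} (R : CommutativeRing c ℓ) where

  open CommutativeRing R renaming (refl to ≈-refl; sym to ≈-sym; trans to ≈-trans)
  open import Algebra.Properties.Ring ring using (-‿distribˡ-*)
  open import Algebra.Properties.AbelianGroup +-abelianGroup using (⁻¹-∙-comm)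
  open import Algebra.Properties.Group +-group using (ε⁻¹≈ε; ⁻¹-involutive)
  open import Algebra.Properties.CommutativeSemigroup +-commutativeSemigroup
    using (interchange)
  open import Algebra.Properties.Semiring.Mult.TCOptimised semiring
    using (×-homo-+) renaming (_×_ to _·_)
  open import Relation.Binary.Reasoning.Setoid (CommutativeRing.setoid R)

  private
    ⟦_⟧ℤ : ℤ → Carrier
    ⟦ ℤ.+ n ⟧ℤ    = n · 1#
    ⟦ -[1+ n ] ⟧ℤ = - (suc n · 1#)

    suc·1# : ∀ n → suc n · 1# ≈ 1# + n · 1#
    suc·1# n = ×-homo-+ 1# 1 n

    ⊖-homo : ∀ m n → ⟦ m ⊖ n ⟧ℤ ≈ m · 1# - n · 1#
    ⊖-homo m zero = begin
      m · 1#        ≈⟨ +-identityʳ _ ⟨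
      m · 1# + 0#   ≈⟨ +-congˡ ε⁻¹≈ε ⟨
      m · 1# - 0#   ∎
    ⊖-homo zero (suc n) = ≈-sym (+-identityˡ _)
    ⊖-homo (suc m) (suc n) = begin
      ⟦ suc m ⊖ suc n ⟧ℤ               ≡⟨ cong ⟦_⟧ℤ (ℤ.[1+m]⊖[1+n]≡m⊖n m n) ⟩
      ⟦ m ⊖ n ⟧ℤ                       ≈⟨ ⊖-homo m n ⟩
      m · 1# - n · 1#                  ≈⟨ +-identityˡ _ ⟨
      0# + (m · 1# - n · 1#)           ≈⟨ +-congʳ (-‿inverseʳ 1#) ⟨
      (1# - 1#) + (m · 1# - n · 1#)    ≈⟨ interchange 1# (- 1#) (m · 1#) (- (n · 1#)) ⟩
      (1# + m · 1#) + (- 1# - n · 1#)  ≈⟨ +-congˡ (⁻¹-∙-comm 1# (n · 1#)) ⟩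
      (1# + m · 1#) - (1# + n · 1#)    ≈⟨ +-cong (suc·1# m) (-‿cong (suc·1# n)) ⟨
      suc m · 1# - suc n · 1#          ∎

    +-homo : ∀ i j → ⟦ i ℤ.+ j ⟧ℤ ≈ ⟦ i ⟧ℤ + ⟦ j ⟧ℤ
    +-homo (ℤ.+ m)  (ℤ.+ n)  = ×-homo-+ 1# m n
    +-homo (ℤ.+ m)  -[1+ n ] = ⊖-homo m (suc n)
    +-homo -[1+ m ] (ℤ.+ n)  = ≈-trans (⊖-homo n (suc m)) (+-comm _ _)
    +-homo -[1+ m ] -[1+ n ] = begin
      - (suc (suc (m ℕ.+ n)) · 1#)  ≡⟨ cong (λ k → - (suc k · 1#)) (ℕ.+-suc m n) ⟨
      - ((suc m ℕ.+ suc n) · 1#)    ≈⟨ -‿cong (×-homo-+ 1# (suc m) (suc n)) ⟩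
      - (suc m · 1# + suc n · 1#)   ≈⟨ ⁻¹-∙-comm _ _ ⟨
      - (suc m · 1#) - suc n · 1#   ∎

    -‿homo : ∀ i → ⟦ ℤ.- i ⟧ℤ ≈ - ⟦ i ⟧ℤ
    -‿homo (ℤ.+ zero)  = ≈-sym ε⁻¹≈ε
    -‿homo (ℤ.+ suc n) = ≈-refl
    -‿homo -[1+ n ]    = ≈-sym (⁻¹-involutive _)

    *-homo-+ : ∀ m j → ⟦ ℤ.+ m ℤ.* j ⟧ℤ ≈ m · 1# * ⟦ j ⟧ℤ
    *-homo-+ zero    j = ≈-sym (zeroˡ _)
    *-homo-+ (suc m) j = begin
      ⟦ ℤ.+ suc m ℤ.* j ⟧ℤ           ≡⟨ cong ⟦_⟧ℤ (ℤ.suc-* (ℤ.+ m) j) ⟩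
      ⟦ j ℤ.+ ℤ.+ m ℤ.* j ⟧ℤ         ≈⟨ +-homo j (ℤ.+ m ℤ.* j) ⟩
      ⟦ j ⟧ℤ + ⟦ ℤ.+ m ℤ.* j ⟧ℤ      ≈⟨ +-cong (≈-sym (*-identityˡ _)) (*-homo-+ m j) ⟩
      1# * ⟦ j ⟧ℤ + m · 1# * ⟦ j ⟧ℤ  ≈⟨ distribʳ _ _ _ ⟨
      (1# + m · 1#) * ⟦ j ⟧ℤ         ≈⟨ *-congʳ (suc·1# m) ⟨
      suc m · 1# * ⟦ j ⟧ℤ            ∎

    *-homo : ∀ i j → ⟦ i ℤ.* j ⟧ℤ ≈ ⟦ i ⟧ℤ * ⟦ j ⟧ℤ
    *-homo (ℤ.+ m)  j = *-homo-+ m j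
    *-homo -[1+ m ] j = begin
      ⟦ -[1+ m ] ℤ.* j ⟧ℤ         ≡⟨ cong ⟦_⟧ℤ (ℤ.neg-distribˡ-* (ℤ.+ suc m) j) ⟨
      ⟦ ℤ.- (ℤ.+ suc m ℤ.* j) ⟧ℤ  ≈⟨ -‿homo (ℤ.+ suc m ℤ.* j) ⟩
      - ⟦ ℤ.+ suc m ℤ.* j ⟧ℤ      ≈⟨ -‿cong (*-homo-+ (suc m) j) ⟩
      - (suc m · 1# * ⟦ j ⟧ℤ)     ≈⟨ -‿distribˡ-* _ _ ⟩
      - (suc m · 1#) * ⟦ j ⟧ℤ     ∎

    ℤ-morphism : ℤ.+-*-rawRing -Raw-AlmostCommutative⟶ fromCommutativeRing R
    ℤ-morphism = record
      { ⟦_⟧    = ⟦_⟧ℤ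
      ; +-homo = +-homo
      ; *-homo = *-homo
      ; -‿homo = -‿homo
      ; 0-homo = ≈-refl
      ; 1-homo = ≈-refl
      }

    ⟦⟧ℤ-≟ : ∀ i j → Maybe (⟦ i ⟧ℤ ≈ ⟦ j ⟧ℤ)
    ⟦⟧ℤ-≟ i j = Maybe.map (λ { refl → ≈-refl }) (dec⇒weaklyDec ℤ._≟_ i j)

  open import Algebra.Solver.Ring ℤ.+-*-rawRing (fromCommutativeRing R) ℤ-morphism ⟦⟧ℤ-≟ public

-- RatFun's operations, verbatim but over any raw ring.  On the field they
-- compute exactly what RatFun computes; on solver syntax they produce the
-- expressions the ring solver needs to reason about those results.
module ListPolynomials {c ℓ} (R : RawRing c ℓ) where

  open RawRing R
  open import Algebra.Definitions.RawSemiring rawSemiring using (_^_)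

  Poly : Set c
  Poly = List Carrier

  coeff : Poly → ℕ → Carrier
  coeff []       _       = 0#
  coeff (a ∷ p)  zero    = a
  coeff (a ∷ p)  (suc n) = coeff p n

  _⊕_ : Poly → Poly → Poly
  []      ⊕ q       = q
  (a ∷ p) ⊕ []      = a ∷ p
  (a ∷ p) ⊕ (b ∷ q) = (a + b) ∷ (p ⊕ q)

  scal : Carrier → Poly → Poly
  scal c p = map (c *_) p

  _⊗_ : Poly → Poly → Poly
  []      ⊗ q = []
  (a ∷ p) ⊗ q = scal a q ⊕ (0# ∷ (p ⊗ q))

  pow : Poly → ℕ → Poly
  pow p zero    = 1# ∷ []
  pow p (suc n) = p ⊗ pow p n

  homog : Poly → Poly → Poly → ℕ → Poly
  homog L M []       m = []
  homog L M (p ∷ ps) m = scal p (pow M m) ⊕ (L ⊗ homog L M ps (m ∸ 1))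

  -- numerator and denominator of RatFun.precomp (fA t) φ for φ = (αX + β)/(γX + δ)
  precompNum : Carrier → Carrier → Carrier → Carrier → Carrier → Poly
  precompNum t α β γ δ = homog (β ∷ α ∷ []) (δ ∷ γ ∷ []) (t ∷ 0# ∷ 1# ∷ 1# ∷ []) 4

  precompDen : Carrier → Carrier → Carrier → Carrier → Poly
  precompDen α β γ δ = homog (β ∷ α ∷ []) (δ ∷ γ ∷ []) (0# ∷ 1# ∷ []) 4

  linear·X : Carrier → Carrier → Poly
  linear·X r₀ r₁ = 0# ∷ r₀ ∷ r₁ ∷ []

  linear·cubic : Carrier → Carrier → Carrier → Poly
  linear·cubic t′ r₀ r₁ = t′ * r₀ ∷ t′ * r₁ ∷ 0# ∷ r₀ ∷ r₁ ∷ []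

  -- w^m p(u/w) for p of degree at most m
  homogeneousEval : ℕ → Poly → Carrier → Carrier → Carrier
  homogeneousEval m []      u w = 0#
  homogeneousEval m (a ∷ p) u w = a * w ^ m + u * homogeneousEval (m ∸ 1) p u w

module _ (K : FiniteField) where

  open FiniteField K
  open RatFun K

  commutativeRing : CommutativeRing 0ℓ 0ℓ
  commutativeRing = record { isCommutativeRing = isCommutativeRing }

  open CommutativeRing commutativeRing
    using ( _-_; rawRing; +-identityˡ; +-identityʳ; *-identityˡ; *-identityʳ; zeroˡ; zeroʳ; *-comm
          ; -‿inverseʳ)
  open import Algebra.Definitions.RawSemiring (RawRing.rawSemiring rawRing) using (_^_)
  open import Algebra.Properties.Group (CommutativeRing.+-group commutativeRing)
    using (inverseˡ-unique; x≈y⇒x∙y⁻¹≈ε)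
  open IntegerCoefficientSolver commutativeRing
    using (solve; _:=_; _:+_; _:-_; _:*_; :-_; _:^_; con; Polynomial)
  open ListPolynomials rawRing
    using (precompNum; precompDen; linear·X; linear·cubic; homogeneousEval)
  open ≡-Reasoning

  expressionRing : ℕ → RawRing 0ℓ 0ℓ
  expressionRing n = record
    { Carrier = Polynomial n ; _≈_ = _≡_
    ; _+_ = _:+_ ; _*_ = _:*_ ; -_ = :-_ ; 0# = con 0ℤ ; 1# = con 1ℤ }

  module Expr {n} = ListPolynomials (expressionRing n)

  infix 4 _≟_
  _≟_ : DecidableEquality F
  _≟_ = via-injection (↔⇒↣ enum) Fin._≟_

  x*y≡0⇒y≡0 : ∀ {x y} → x ≢ 0# → x * y ≡ 0# → y ≡ 0#
  x*y≡0⇒y≡0 {x} {y} x≢0 xy≡0 with inverse x x≢0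
  ... | x⁻¹ , xx⁻¹≡1 = begin
    y                ≡⟨ *-identityˡ y ⟨
    1# * y           ≡⟨ cong (_* y) xx⁻¹≡1 ⟨
    (x * x⁻¹) * y    ≡⟨ solve 3 (λ x x⁻¹ y → (x :* x⁻¹) :* y := x⁻¹ :* (x :* y)) refl x x⁻¹ y ⟩
    x⁻¹ * (x * y)    ≡⟨ cong (x⁻¹ *_) xy≡0 ⟩
    x⁻¹ * 0#         ≡⟨ zeroʳ x⁻¹ ⟩
    0#               ∎

  x*y≡0⇒x≡0 : ∀ {x y} → y ≢ 0# → x * y ≡ 0# → x ≡ 0#
  x*y≡0⇒x≡0 {x} {y} y≢0 xy≡0 = x*y≡0⇒y≡0 y≢0 (trans (*-comm y x) xy≡0)

  *-≢0 : ∀ {x y} → x ≢ 0# → y ≢ 0# → x * y ≢ 0#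
  *-≢0 x≢0 y≢0 xy≡0 = y≢0 (x*y≡0⇒y≡0 x≢0 xy≡0)

  ^-≢0 : ∀ {x} n → x ≢ 0# → x ^ n ≢ 0#
  ^-≢0 zero    x≢0 = 0≢1 ∘ sym
  ^-≢0 (suc n) x≢0 = *-≢0 x≢0 (^-≢0 n x≢0)

  X : Poly
  X = 0# ∷ 1# ∷ []

  cubic : F → Poly
  cubic c = c ∷ 0# ∷ 0# ∷ 1# ∷ []

  coeff-⊕ : ∀ p q n → coeff (p ⊕ q) n ≡ coeff p n + coeff q n
  coeff-⊕ []      q       n       = sym (+-identityˡ _)
  coeff-⊕ (a ∷ p) []      n       = sym (+-identityʳ _)
  coeff-⊕ (a ∷ p) (b ∷ q) zero    = refl
  coeff-⊕ (a ∷ p) (b ∷ q) (suc n) = coeff-⊕ p q n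

  coeff-scal : ∀ c p n → coeff (scal c p) n ≡ c * coeff p n
  coeff-scal c []      n       = sym (zeroʳ c)
  coeff-scal c (a ∷ p) zero    = refl
  coeff-scal c (a ∷ p) (suc n) = coeff-scal c p n

  coeff-combination : ∀ x p y q n → coeff (scal x p ⊕ scal y q) n ≡ x * coeff p n + y * coeff q n
  coeff-combination x p y q n =
    trans (coeff-⊕ (scal x p) (scal y q) n) (cong₂ _+_ (coeff-scal x p n) (coeff-scal y q n))

  coeff-∷⊗ : ∀ a p q n → coeff ((a ∷ p) ⊗ q) n ≡ a * coeff q n + coeff (0# ∷ (p ⊗ q)) n
  coeff-∷⊗ a p q n = trans (coeff-⊕ (scal a q) (0# ∷ (p ⊗ q)) n) (cong (_+ _) (coeff-scal a q n))

  ∷-cong : ∀ a {p q} → p ≈ₚ q → (a ∷ p) ≈ₚ (a ∷ q)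
  ∷-cong a p≈q zero    = refl
  ∷-cong a p≈q (suc n) = p≈q n

  0∷⊗ : ∀ p q → ((0# ∷ p) ⊗ q) ≈ₚ (0# ∷ (p ⊗ q))
  0∷⊗ p q n = trans (coeff-∷⊗ 0# p q n)
    (trans (cong (_+ coeff (0# ∷ (p ⊗ q)) n) (zeroˡ (coeff q n))) (+-identityˡ _))

  1⊗ : ∀ q → ((1# ∷ []) ⊗ q) ≈ₚ q
  1⊗ q n = trans (coeff-∷⊗ 1# [] q n)
    (trans (cong₂ _+_ (*-identityˡ _) (coeff-0∷[] n)) (+-identityʳ _))
    where
    coeff-0∷[] : ∀ n → coeff (0# ∷ []) n ≡ 0#
    coeff-0∷[] zero    = refl
    coeff-0∷[] (suc n) = refl

  ⊗X : ∀ p → (p ⊗ X) ≈ₚ (0# ∷ p)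
  ⊗X []      zero          = refl
  ⊗X []      (suc n)       = refl
  ⊗X (a ∷ p) n = trans (coeff-∷⊗ a p X n) (shift n)
    where
    shift : ∀ n → a * coeff X n + coeff (0# ∷ (p ⊗ X)) n ≡ coeff (0# ∷ a ∷ p) n
    shift zero          = trans (cong (_+ 0#) (zeroʳ a)) (+-identityʳ 0#)
    shift (suc zero)    = trans (cong₂ _+_ (*-identityʳ a) (⊗X p 0)) (+-identityʳ a)
    shift (suc (suc n)) = trans (cong (_+ coeff (p ⊗ X) (suc n)) (zeroʳ a))
                            (trans (+-identityˡ _) (⊗X p (suc n)))

  coeff-cubic⊗ : ∀ c q n → coeff (cubic c ⊗ q) n ≡ c * coeff q n + coeff (0# ∷ 0# ∷ 0# ∷ q) n
  coeff-cubic⊗ c q n =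
    trans (coeff-∷⊗ c (0# ∷ 0# ∷ 1# ∷ []) q n) (cong ((c * coeff q n) +_) (∷-cong 0# X²⊗ n))
    where
    X²⊗ : ((0# ∷ 0# ∷ 1# ∷ []) ⊗ q) ≈ₚ (0# ∷ 0# ∷ q)
    X²⊗ m = trans (0∷⊗ (0# ∷ 1# ∷ []) q m)
                  (∷-cong 0# (λ k → trans (0∷⊗ (1# ∷ []) q k) (∷-cong 0# (1⊗ q) k)) m)

  record Span (A B V : Poly) : Set where
    constructor span
    field
      x y     : F
      V≈xA+yB : V ≈ₚ (scal x A ⊕ scal y B)

  Pencil : F → F → F → Poly → Set
  Pencil t′ r₀ r₁ = Span (linear·X r₀ r₁) (linear·cubic t′ r₀ r₁)

  span-cong : ∀ {A B V W} → V ≈ₚ W → Span A B W → Span A B V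
  span-cong V≈W (span x y W≈) = span x y λ n → trans (V≈W n) (W≈ n)

  span-left : ∀ {A B V} → V ≈ₚ A → Span A B V
  span-left {A} {B} {V} V≈A = span 1# 0# λ n → begin
    coeff V n                            ≡⟨ V≈A n ⟩
    coeff A n                            ≡⟨ solve 2 (λ a b → a := con 1ℤ :* a :+ con 0ℤ :* b) refl _ _ ⟩
    1# * coeff A n + 0# * coeff B n      ≡⟨ coeff-combination 1# A 0# B n ⟨
    coeff (scal 1# A ⊕ scal 0# B) n      ∎

  span-right : ∀ {A B V} → V ≈ₚ B → Span A B V
  span-right {A} {B} {V} V≈B = span 0# 1# λ n → begin
    coeff V n                            ≡⟨ V≈B n ⟩
    coeff B n                            ≡⟨ solve 2 (λ a b → b := con 0ℤ :* a :+ con 1ℤ :* b) refl _ _ ⟩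
    0# * coeff A n + 1# * coeff B n      ≡⟨ coeff-combination 0# A 1# B n ⟨
    coeff (scal 0# A ⊕ scal 1# B) n      ∎

  span-coeff : ∀ {A B V} (V∈ : Span A B V) n →
               coeff V n ≡ Span.x V∈ * coeff A n + Span.y V∈ * coeff B n
  span-coeff {A} {B} (span x y V≈) n = trans (V≈ n) (coeff-combination x A y B n)

  span-combination : ∀ {A B V W} u w → Span A B V → Span A B W → Span A B (scal u V ⊕ scal w W)
  span-combination {A} {B} {V} {W} u w V∈@(span x y _) W∈@(span x′ y′ _) =
    span (u * x + w * x′) (u * y + w * y′) λ n → begin
      coeff (scal u V ⊕ scal w W) n                                  ≡⟨ coeff-combination u V w W n ⟩
      u * coeff V n + w * coeff W n                                  ≡⟨ cong₂ (λ v v′ → u * v + w * v′)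
                                                                          (span-coeff V∈ n) (span-coeff W∈ n) ⟩
      u * (x * coeff A n + y * coeff B n) + w * (x′ * coeff A n + y′ * coeff B n)
        ≡⟨ solve 8 (λ u w x y x′ y′ a b →
             u :* (x :* a :+ y :* b) :+ w :* (x′ :* a :+ y′ :* b)
               := (u :* x :+ w :* x′) :* a :+ (u :* y :+ w :* y′) :* b) refl u w x y x′ y′ _ _ ⟩
      (u * x + w * x′) * coeff A n + (u * y + w * y′) * coeff B n    ≡⟨ coeff-combination _ A _ B n ⟨
      coeff (scal (u * x + w * x′) A ⊕ scal (u * y + w * y′) B) n    ∎

  fB≈ᵣ⇒pencil : ∀ {t′} g → t′ ≢ 0# →
                (∀ n → coeff (num g) (5 ℕ.+ n) ≡ 0#) → (∀ n → coeff (den g) (5 ℕ.+ n) ≡ 0#) →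
                fB t′ ≈ᵣ g →
                Pencil t′ (coeff (den g) 1) (coeff (den g) 2) (num g) ×
                Pencil t′ (coeff (den g) 1) (coeff (den g) 2) (den g)
  fB≈ᵣ⇒pencil {t′} (P / Q) t′≢0 deg-P deg-Q fB≈P/Q = span-right P≈ , span-left Q≈
    where
    p q : ℕ → F
    p = coeff P
    q = coeff Q

    coeffs : ∀ n → t′ * q n + coeff (0# ∷ 0# ∷ 0# ∷ Q) n ≡ coeff (0# ∷ P) n
    coeffs n = trans (sym (coeff-cubic⊗ t′ Q n)) (trans (fB≈P/Q n) (⊗X P n))

    top : ∀ k → q (2 ℕ.+ k) ≡ p (4 ℕ.+ k)
    top k = begin
      q (2 ℕ.+ k)                      ≡⟨ solve 2 (λ t′ q → q := t′ :* con 0ℤ :+ q) refl t′ _ ⟩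
      t′ * 0# + q (2 ℕ.+ k)            ≡⟨ cong (λ z → t′ * z + q (2 ℕ.+ k)) (deg-Q k) ⟨
      t′ * q (5 ℕ.+ k) + q (2 ℕ.+ k)   ≡⟨ coeffs (5 ℕ.+ k) ⟩
      p (4 ℕ.+ k)                      ∎

    q₀≡0 : q 0 ≡ 0#
    q₀≡0 = x*y≡0⇒y≡0 t′≢0 (trans (sym (+-identityʳ _)) (coeffs 0))

    q₃≡0 : q 3 ≡ 0#
    q₃≡0 = trans (top 1) (deg-P 0)

    q₄≡0 : q 4 ≡ 0#
    q₄≡0 = trans (top 2) (deg-P 1)

    Q≈ : Q ≈ₚ linear·X (q 1) (q 2)
    Q≈ 0 = q₀≡0
    Q≈ 1 = refl
    Q≈ 2 = refl
    Q≈ 3 = q₃≡0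
    Q≈ 4 = q₄≡0
    Q≈ (suc (suc (suc (suc (suc k))))) = deg-Q k

    P≈ : P ≈ₚ linear·cubic t′ (q 1) (q 2)
    P≈ 0 = trans (sym (coeffs 1)) (+-identityʳ _)
    P≈ 1 = trans (sym (coeffs 2)) (+-identityʳ _)
    P≈ 2 = begin
      p 2               ≡⟨ coeffs 3 ⟨
      t′ * q 3 + q 0    ≡⟨ cong₂ (λ a b → t′ * a + b) q₃≡0 q₀≡0 ⟩
      t′ * 0# + 0#      ≡⟨ solve 1 (λ t′ → t′ :* con 0ℤ :+ con 0ℤ := con 0ℤ) refl t′ ⟩
      0#                ∎
    P≈ 3 = begin
      p 3               ≡⟨ coeffs 4 ⟨
      t′ * q 4 + q 1    ≡⟨ cong (λ a → t′ * a + q 1) q₄≡0 ⟩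
      t′ * 0# + q 1     ≡⟨ solve 2 (λ t′ q₁ → t′ :* con 0ℤ :+ q₁ := q₁) refl t′ (q 1) ⟩
      q 1               ∎
    P≈ 4 = sym (top 0)
    P≈ (suc (suc (suc (suc (suc k))))) = deg-P k

  -- Postcomposition is undone by ψ⁻¹ = (dX - b)/(-cX + a)
  span-postcomp⁻¹ : ∀ {A B} ψ f → Span A B (num (postcomp ψ f)) → Span A B (den (postcomp ψ f)) →
                    Span A B (num f) × Span A B (den f)
  span-postcomp⁻¹ record { a = a ; b = b ; c = c ; d = d ; det≢0 = Δ≢0 } (N / D) P∈ Q∈
    with inverse (a * d - b * c) Δ≢0
  ... | e , Δe≡1 = span-cong N≈ (span-combination (e * d) (e * - b) P∈ Q∈)
                 , span-cong D≈ (span-combination (e * - c) (e * a) P∈ Q∈)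
    where
    P Q : Poly
    P = scal a N ⊕ scal b D
    Q = scal c N ⊕ scal d D

    coeff-PQ : ∀ x y n → coeff (scal x P ⊕ scal y Q) n
                       ≡ x * (a * coeff N n + b * coeff D n) + y * (c * coeff N n + d * coeff D n)
    coeff-PQ x y n = trans (coeff-combination x P y Q n)
      (cong₂ (λ p q → x * p + y * q) (coeff-combination a N b D n) (coeff-combination c N d D n))

    N≈ : N ≈ₚ (scal (e * d) P ⊕ scal (e * - b) Q)
    N≈ n = begin
      coeff N n                          ≡⟨ *-identityˡ _ ⟨
      1# * coeff N n                     ≡⟨ cong (_* coeff N n) Δe≡1 ⟨
      (a * d - b * c) * e * coeff N n    ≡⟨ solve 7 (λ a b c d e n m →
                                              (a :* d :- b :* c) :* e :* n
                                                := e :* d :* (a :* n :+ b :* m) :+ e :* (:- b) :* (c :* n :+ d :* m))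
                                              refl a b c d e (coeff N n) (coeff D n) ⟩
      e * d * (a * coeff N n + b * coeff D n) + e * - b * (c * coeff N n + d * coeff D n)
                                         ≡⟨ coeff-PQ (e * d) (e * - b) n ⟨
      coeff (scal (e * d) P ⊕ scal (e * - b) Q) n ∎

    D≈ : D ≈ₚ (scal (e * - c) P ⊕ scal (e * a) Q)
    D≈ n = begin
      coeff D n                          ≡⟨ *-identityˡ _ ⟨
      1# * coeff D n                     ≡⟨ cong (_* coeff D n) Δe≡1 ⟨
      (a * d - b * c) * e * coeff D n    ≡⟨ solve 7 (λ a b c d e n m →
                                              (a :* d :- b :* c) :* e :* m
                                                := e :* (:- c) :* (a :* n :+ b :* m) :+ e :* a :* (c :* n :+ d :* m))
                                              refl a b c d e (coeff N n) (coeff D n) ⟩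
      e * - c * (a * coeff N n + b * coeff D n) + e * a * (c * coeff N n + d * coeff D n)
                                         ≡⟨ coeff-PQ (e * - c) (e * a) n ⟨
      coeff (scal (e * - c) P ⊕ scal (e * a) Q) n ∎

  pencil-coeff₀ : ∀ {t′ r₀ r₁ V} → Pencil t′ r₀ r₁ V → coeff V 0 ≡ t′ * coeff V 3
  pencil-coeff₀ {t′} {r₀} {r₁} {V} V∈@(span x y _) = begin
    coeff V 0               ≡⟨ span-coeff V∈ 0 ⟩
    x * 0# + y * (t′ * r₀)  ≡⟨ solve 4 (λ t′ r₀ x y → x :* con 0ℤ :+ y :* (t′ :* r₀)
                                                      := t′ :* (x :* con 0ℤ :+ y :* r₀)) refl t′ r₀ x y ⟩
    t′ * (x * 0# + y * r₀)  ≡⟨ cong (t′ *_) (span-coeff V∈ 3) ⟨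
    t′ * coeff V 3          ∎

  pencil-coeff₄ : ∀ {t′ r₀ r₁ V} → Pencil t′ r₀ r₁ V → r₁ * coeff V 3 ≡ r₀ * coeff V 4
  pencil-coeff₄ {t′} {r₀} {r₁} {V} V∈@(span x y _) = begin
    r₁ * coeff V 3          ≡⟨ cong (r₁ *_) (span-coeff V∈ 3) ⟩
    r₁ * (x * 0# + y * r₀)  ≡⟨ solve 4 (λ r₀ r₁ x y → r₁ :* (x :* con 0ℤ :+ y :* r₀)
                                                     := r₀ :* (x :* con 0ℤ :+ y :* r₁)) refl r₀ r₁ x y ⟩
    r₀ * (x * 0# + y * r₁)  ≡⟨ cong (r₀ *_) (span-coeff V∈ 4) ⟨
    r₀ * coeff V 4          ∎

  pencil-coeff₂ : ∀ {t′ r₀ r₁ V} → Pencil t′ r₀ r₁ V →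
                  r₀ * coeff V 2 ≡ r₁ * (coeff V 1 - t′ * coeff V 4)
  pencil-coeff₂ {t′} {r₀} {r₁} {V} V∈@(span x y _) = begin
    r₀ * coeff V 2
      ≡⟨ cong (r₀ *_) (span-coeff V∈ 2) ⟩
    r₀ * (x * r₁ + y * 0#)
      ≡⟨ solve 5 (λ t′ r₀ r₁ x y →
           r₀ :* (x :* r₁ :+ y :* con 0ℤ)
             := r₁ :* ((x :* r₀ :+ y :* (t′ :* r₁)) :- t′ :* (x :* con 0ℤ :+ y :* r₁)))
           refl t′ r₀ r₁ x y ⟩
    r₁ * ((x * r₀ + y * (t′ * r₁)) - t′ * (x * 0# + y * r₁))
      ≡⟨ cong₂ (λ v₁ v₄ → r₁ * (v₁ - t′ * v₄)) (span-coeff V∈ 1) (span-coeff V∈ 4) ⟨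
    r₁ * (coeff V 1 - t′ * coeff V 4)
      ∎

  homogeneousEval-≈[] : ∀ m p {u w} → p ≈ₚ [] → homogeneousEval m p u w ≡ 0#
  homogeneousEval-≈[] m []      p≈[] = refl
  homogeneousEval-≈[] m (a ∷ p) {u} {w} p≈[] = begin
    a * w ^ m + u * homogeneousEval (m ∸ 1) p u w
      ≡⟨ cong₂ (λ a h → a * w ^ m + u * h) (p≈[] 0) (homogeneousEval-≈[] (m ∸ 1) p (p≈[] ∘ suc)) ⟩
    0# * w ^ m + u * 0#
      ≡⟨ solve 2 (λ u wᵐ → con 0ℤ :* wᵐ :+ u :* con 0ℤ := con 0ℤ) refl u (w ^ m) ⟩
    0# ∎

  homogeneousEval-cong : ∀ m p q {u w} → p ≈ₚ q → homogeneousEval m p u w ≡ homogeneousEval m q u w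
  homogeneousEval-cong m []      q       p≈q = sym (homogeneousEval-≈[] m q (sym ∘ p≈q))
  homogeneousEval-cong m (a ∷ p) []      p≈q = homogeneousEval-≈[] m (a ∷ p) p≈q
  homogeneousEval-cong m (a ∷ p) (b ∷ q) {u} {w} p≈q =
    cong₂ (λ c h → c * w ^ m + u * h) (p≈q 0) (homogeneousEval-cong (m ∸ 1) p q (p≈q ∘ suc))

  pencil-vanishes : ∀ {t′ r₀ r₁ V u w} → Pencil t′ r₀ r₁ V → r₀ * w + r₁ * u ≡ 0# →
                    homogeneousEval 4 V u w ≡ 0#
  pencil-vanishes {t′} {r₀} {r₁} {V} {u} {w} (span x y V≈) R≡0 = begin
    homogeneousEval 4 V u w
      ≡⟨ homogeneousEval-cong 4 V xA+yB V≈ ⟩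
    homogeneousEval 4 xA+yB u w
      ≡⟨ solve 7 (λ t′ r₀ r₁ x y u w →
           Expr.homogeneousEval 4
             (Expr.scal x (Expr.linear·X r₀ r₁) Expr.⊕ Expr.scal y (Expr.linear·cubic t′ r₀ r₁)) u w
             := (r₀ :* w :+ r₁ :* u) :* (x :* u :* w :^ 2 :+ y :* (u :^ 3 :+ t′ :* w :^ 3)))
           refl t′ r₀ r₁ x y u w ⟩
    (r₀ * w + r₁ * u) * (x * u * w ^ 2 + y * (u ^ 3 + t′ * w ^ 3))
      ≡⟨ cong (_* (x * u * w ^ 2 + y * (u ^ 3 + t′ * w ^ 3))) R≡0 ⟩
    0# * (x * u * w ^ 2 + y * (u ^ 3 + t′ * w ^ 3))
      ≡⟨ zeroˡ _ ⟩
    0# ∎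
    where
    xA+yB : Poly
    xA+yB = scal x (linear·X r₀ r₁) ⊕ scal y (linear·cubic t′ r₀ r₁)

  homogeneousEval-precompDen : ∀ α β γ δ u w →
    homogeneousEval 4 (precompDen α β γ δ) u w ≡ (α * u + β * w) * (γ * u + δ * w) ^ 3
  homogeneousEval-precompDen = solve 6 (λ α β γ δ u w →
    Expr.homogeneousEval 4 (Expr.precompDen α β γ δ) u w
      := (α :* u :+ β :* w) :* (γ :* u :+ δ :* w) :^ 3) refl

  homogeneousEval-precompNum : ∀ t α β γ δ u w → let L = α * u + β * w; M = γ * u + δ * w in
    homogeneousEval 4 (precompNum t α β γ δ) u w ≡ t * M ^ 4 + L ^ 2 * M ^ 2 + L ^ 3 * M
  homogeneousEval-precompNum = solve 7 (λ t α β γ δ u w →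
    let L = α :* u :+ β :* w; M = γ :* u :+ δ :* w in
    Expr.homogeneousEval 4 (Expr.precompNum t α β γ δ) u w
      := t :* M :^ 4 :+ L :^ 2 :* M :^ 2 :+ L :^ 3 :* M) refl

  common-zero⇒M≡0 : ∀ {t α β γ δ u w} → t ≢ 0# →
                    homogeneousEval 4 (precompNum t α β γ δ) u w ≡ 0# →
                    homogeneousEval 4 (precompDen α β γ δ) u w ≡ 0# → γ * u + δ * w ≡ 0#
  common-zero⇒M≡0 {t} {α} {β} {γ} {δ} {u} {w} t≢0 N≡0 D≡0 with γ * u + δ * w ≟ 0#
  ... | yes M≡0 = M≡0
  ... | no M≢0  = ⊥-elim (*-≢0 t≢0 (^-≢0 4 M≢0) (begin
    t * M ^ 4
      ≡⟨ solve 2 (λ t M → t :* M :^ 4 := t :* M :^ 4 :+ con 0ℤ :^ 2 :* M :^ 2 :+ con 0ℤ :^ 3 :* M)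
           refl t M ⟩
    t * M ^ 4 + 0# ^ 2 * M ^ 2 + 0# ^ 3 * M
      ≡⟨ cong (λ l → t * M ^ 4 + l ^ 2 * M ^ 2 + l ^ 3 * M) L≡0 ⟨
    t * M ^ 4 + L ^ 2 * M ^ 2 + L ^ 3 * M
      ≡⟨ homogeneousEval-precompNum t α β γ δ u w ⟨
    homogeneousEval 4 (precompNum t α β γ δ) u w
      ≡⟨ N≡0 ⟩
    0# ∎))
    where
    L M : F
    L = α * u + β * w
    M = γ * u + δ * w

    L≡0 : L ≡ 0#
    L≡0 = x*y≡0⇒x≡0 (^-≢0 3 M≢0) (trans (sym (homogeneousEval-precompDen α β γ δ u w)) D≡0)

  -- M vanishes at the root ∞ of the constant R, so γ = 0; then D = δ³(αX + β) lies in
  -- ⟨X, X³ + t′⟩ only if β = 0, and then the X²-coefficient (αδ)² of N must vanish.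
  constant-R-case : ∀ {t t′ α β γ δ r₀} → α * δ - β * γ ≢ 0# → r₀ ≢ 0# → γ * - r₀ + δ * 0# ≡ 0# →
                    Pencil t′ r₀ 0# (precompNum t α β γ δ) → Pencil t′ r₀ 0# (precompDen α β γ δ) → ⊥
  constant-R-case {t} {t′} {α} {β} {γ} {δ} {r₀} det≢0 r₀≢0 M≡0 N∈ D∈ = ^-≢0 2 αδ≢0 (begin
    (α * δ) ^ 2
      ≡⟨ solve 4 (λ t α β δ → (α :* δ) :^ 2
                   := Expr.coeff (Expr.precompNum t α β (con 0ℤ) δ) 2 :- con (ℤ.+ 3) :* α :^ 2 :* δ :* β)
           refl t α β δ ⟩
    coeff (precompNum t α β 0# δ) 2 - (1# + 1# + 1#) * α ^ 2 * δ * β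
      ≡⟨ cong₂ (λ n b → n - (1# + 1# + 1#) * α ^ 2 * δ * b) N₂≡0 β≡0 ⟩
    0# - (1# + 1# + 1#) * α ^ 2 * δ * 0#
      ≡⟨ solve 2 (λ α δ → con 0ℤ :- con (ℤ.+ 3) :* α :^ 2 :* δ :* con 0ℤ := con 0ℤ) refl α δ ⟩
    0# ∎)
    where
    γ≡0 : γ ≡ 0#
    γ≡0 = x*y≡0⇒x≡0 r₀≢0 (begin
      γ * r₀                 ≡⟨ solve 3 (λ γ δ r₀ → γ :* r₀ := :- (γ :* (:- r₀) :+ δ :* con 0ℤ))
                                  refl γ δ r₀ ⟩
      - (γ * - r₀ + δ * 0#)  ≡⟨ cong -_ M≡0 ⟩
      - 0#                   ≡⟨ solve 0 (:- con 0ℤ := con 0ℤ) refl ⟩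
      0#                     ∎)

    αδ≢0 : α * δ ≢ 0#
    αδ≢0 αδ≡0 = det≢0 (begin
      α * δ - β * γ    ≡⟨ cong (λ g → α * δ - β * g) γ≡0 ⟩
      α * δ - β * 0#   ≡⟨ solve 3 (λ α β δ → α :* δ :- β :* con 0ℤ := α :* δ) refl α β δ ⟩
      α * δ            ≡⟨ αδ≡0 ⟩
      0#               ∎)

    β≡0 : β ≡ 0#
    β≡0 = x*y≡0⇒x≡0 (^-≢0 3 (λ δ≡0 → αδ≢0 (trans (cong (α *_) δ≡0) (zeroʳ α)))) (begin
      β * δ ^ 3
        ≡⟨ solve 3 (λ α β δ → β :* δ :^ 3 := Expr.coeff (Expr.precompDen α β (con 0ℤ) δ) 0) refl α β δ ⟩
      coeff (precompDen α β 0# δ) 0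
        ≡⟨ cong (λ g → coeff (precompDen α β g δ) 0) γ≡0 ⟨
      coeff (precompDen α β γ δ) 0
        ≡⟨ pencil-coeff₀ D∈ ⟩
      t′ * coeff (precompDen α β γ δ) 3
        ≡⟨ cong (λ g → t′ * coeff (precompDen α β g δ) 3) γ≡0 ⟩
      t′ * coeff (precompDen α β 0# δ) 3
        ≡⟨ solve 4 (λ t′ α β δ → t′ :* Expr.coeff (Expr.precompDen α β (con 0ℤ) δ) 3 := con 0ℤ)
             refl t′ α β δ ⟩
      0# ∎)

    N₂≡0 : coeff (precompNum t α β 0# δ) 2 ≡ 0#
    N₂≡0 = begin
      coeff (precompNum t α β 0# δ) 2  ≡⟨ cong (λ g → coeff (precompNum t α β g δ) 2) γ≡0 ⟨
      coeff (precompNum t α β γ δ) 2   ≡⟨ x*y≡0⇒y≡0 r₀≢0 (trans (pencil-coeff₂ N∈) (zeroˡ _)) ⟩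
      0#                               ∎

  -- R = r₁(X + r) and M = γ(X + r), i.e. r₀ = r r₁ and δ = γ r

  pencil-coeff₄-monic : ∀ {t′ r r₀ r₁ V} → r₁ ≢ 0# → r₀ ≡ r * r₁ → Pencil t′ r₀ r₁ V →
                        coeff V 3 - r * coeff V 4 ≡ 0#
  pencil-coeff₄-monic {r = r} {r₁ = r₁} {V} r₁≢0 refl V∈ = x*y≡0⇒y≡0 r₁≢0 (begin
    r₁ * (coeff V 3 - r * coeff V 4)
      ≡⟨ solve 4 (λ r r₁ v₃ v₄ → r₁ :* (v₃ :- r :* v₄) := r₁ :* v₃ :- r :* r₁ :* v₄)
           refl r r₁ (coeff V 3) (coeff V 4) ⟩
    r₁ * coeff V 3 - r * r₁ * coeff V 4
      ≡⟨ cong (_- r * r₁ * coeff V 4) (pencil-coeff₄ V∈) ⟩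
    r * r₁ * coeff V 4 - r * r₁ * coeff V 4
      ≡⟨ -‿inverseʳ _ ⟩
    0# ∎)

  shared-root-β : ∀ {t′ α β γ r r₀ r₁} → r₁ ≢ 0# → γ ≢ 0# → r₀ ≡ r * r₁ →
                  Pencil t′ r₀ r₁ (precompDen α β γ (γ * r)) → β ≡ - (α * r + α * r)
  shared-root-β {α = α} {β} {γ} {r} r₁≢0 γ≢0 r₀≡rr₁ D∈ =
    inverseˡ-unique β (α * r + α * r) (x*y≡0⇒y≡0 (^-≢0 3 γ≢0) (begin
      γ ^ 3 * (β + (α * r + α * r))
        ≡⟨ solve 4 (λ α β γ r → let D = Expr.precompDen α β γ (γ :* r) in
             γ :^ 3 :* (β :+ (α :* r :+ α :* r)) := Expr.coeff D 3 :- r :* Expr.coeff D 4)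
             refl α β γ r ⟩
      coeff D 3 - r * coeff D 4
        ≡⟨ pencil-coeff₄-monic r₁≢0 r₀≡rr₁ D∈ ⟩
      0# ∎))
    where
    D : Poly
    D = precompDen α β γ (γ * r)

  shared-root-t′ : ∀ {t′ α γ r r₀ r₁} → α * (γ * r) - - (α * r + α * r) * γ ≢ 0# → γ ≢ 0# →
                   Pencil t′ r₀ r₁ (precompDen α (- (α * r + α * r)) γ (γ * r)) → t′ ≡ - (r ^ 3 + r ^ 3)
  shared-root-t′ {t′} {α} {γ} {r} det≢0 γ≢0 D∈ =
    inverseˡ-unique t′ (r ^ 3 + r ^ 3) (x*y≡0⇒y≡0 (*-≢0 det≢0 (^-≢0 2 γ≢0)) (begin
      (α * (γ * r) - - (α * r + α * r) * γ) * γ ^ 2 * (t′ + (r ^ 3 + r ^ 3))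
        ≡⟨ solve 4 (λ t′ α γ r → let D = Expr.precompDen α (:- (α :* r :+ α :* r)) γ (γ :* r) in
             (α :* (γ :* r) :- (:- (α :* r :+ α :* r)) :* γ) :* γ :^ 2 :* (t′ :+ (r :^ 3 :+ r :^ 3))
               := :- (con (ℤ.+ 3) :* (Expr.coeff D 0 :- t′ :* Expr.coeff D 3)))
             refl t′ α γ r ⟩
      - ((1# + 1# + 1#) * (coeff D 0 - t′ * coeff D 3))
        ≡⟨ cong (λ e → - ((1# + 1# + 1#) * e)) (x≈y⇒x∙y⁻¹≈ε (pencil-coeff₀ D∈)) ⟩
      - ((1# + 1# + 1#) * 0#)
        ≡⟨ solve 0 (:- (con (ℤ.+ 3) :* con 0ℤ) := con 0ℤ) refl ⟩
      0# ∎))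
    where
    D : Poly
    D = precompDen α (- (α * r + α * r)) γ (γ * r)

  shared-root-N : ∀ {t α γ r r₀ r₁} → α * (γ * r) - - (α * r + α * r) * γ ≢ 0# →
                  r₁ ≢ 0# → r₀ ≡ r * r₁ →
                  Pencil (- (r ^ 3 + r ^ 3)) r₀ r₁ (precompNum t α (- (α * r + α * r)) γ (γ * r)) → ⊥
  shared-root-N {t} {α} {γ} {r} det≢0 r₁≢0 r₀≡rr₁ N∈ = ^-≢0 4 det≢0 (begin
    (α * (γ * r) - - (α * r + α * r) * γ) ^ 4
      ≡⟨ solve 4 (λ t α γ r →
           let N  = Expr.precompNum t α (:- (α :* r :+ α :* r)) γ (γ :* r)
               t′ = :- (r :^ 3 :+ r :^ 3)
           in (α :* (γ :* r) :- (:- (α :* r :+ α :* r)) :* γ) :^ 4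
                := (con (ℤ.+ 3) :* α :* γ) :^ 2
                     :* ((Expr.coeff N 0 :- t′ :* Expr.coeff N 3)
                         :- con (ℤ.+ 3) :* r :^ 3 :* (Expr.coeff N 3 :- r :* Expr.coeff N 4)))
           refl t α γ r ⟩
    ((1# + 1# + 1#) * α * γ) ^ 2
      * ((coeff N 0 - t′ * coeff N 3) - (1# + 1# + 1#) * r ^ 3 * (coeff N 3 - r * coeff N 4))
      ≡⟨ cong₂ (λ a b → ((1# + 1# + 1#) * α * γ) ^ 2 * (a - (1# + 1# + 1#) * r ^ 3 * b))
               (x≈y⇒x∙y⁻¹≈ε (pencil-coeff₀ N∈)) (pencil-coeff₄-monic r₁≢0 r₀≡rr₁ N∈) ⟩
    ((1# + 1# + 1#) * α * γ) ^ 2 * (0# - (1# + 1# + 1#) * r ^ 3 * 0#)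
      ≡⟨ solve 3 (λ α γ r → (con (ℤ.+ 3) :* α :* γ) :^ 2 :* (con 0ℤ :- con (ℤ.+ 3) :* r :^ 3 :* con 0ℤ)
                              := con 0ℤ)
           refl α γ r ⟩
    0# ∎)
    where
    t′ : F
    t′ = - (r ^ 3 + r ^ 3)

    N : Poly
    N = precompNum t α (- (α * r + α * r)) γ (γ * r)

  linear-R-case : ∀ {t t′ α β γ δ r₀ r₁} → α * δ - β * γ ≢ 0# → r₁ ≢ 0# → γ * - r₀ + δ * r₁ ≡ 0# →
                  Pencil t′ r₀ r₁ (precompNum t α β γ δ) → Pencil t′ r₀ r₁ (precompDen α β γ δ) → ⊥
  linear-R-case {t} {t′} {α} {β} {γ} {δ} {r₀} {r₁} det≢0 r₁≢0 M≡0 N∈ D∈ with inverse r₁ r₁≢0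
  ... | i , r₁i≡1 = shared-root-N det′ r₁≢0 r₀≡rr₁
                      (subst₂ (λ s b → Pencil s r₀ r₁ (precompNum t α b γ (γ * r))) t′≡ β≡ N∈′)
    where
    r : F
    r = r₀ * i

    r₀≡rr₁ : r₀ ≡ r * r₁
    r₀≡rr₁ = begin
      r₀             ≡⟨ *-identityʳ r₀ ⟨
      r₀ * 1#        ≡⟨ cong (r₀ *_) r₁i≡1 ⟨
      r₀ * (r₁ * i)  ≡⟨ solve 3 (λ r₀ r₁ i → r₀ :* (r₁ :* i) := r₀ :* i :* r₁) refl r₀ r₁ i ⟩
      r * r₁         ∎

    δ≡γr : δ ≡ γ * r
    δ≡γr = begin
      δ                                ≡⟨ *-identityʳ δ ⟨
      δ * 1#                           ≡⟨ cong (δ *_) r₁i≡1 ⟨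
      δ * (r₁ * i)                     ≡⟨ solve 5 (λ γ δ r₀ r₁ i → δ :* (r₁ :* i)
                                            := (γ :* (:- r₀) :+ δ :* r₁) :* i :+ γ :* (r₀ :* i))
                                            refl γ δ r₀ r₁ i ⟩
      (γ * - r₀ + δ * r₁) * i + γ * r  ≡⟨ cong (λ m → m * i + γ * r) M≡0 ⟩
      0# * i + γ * r                   ≡⟨ solve 3 (λ i γ r → con 0ℤ :* i :+ γ :* r := γ :* r) refl i γ r ⟩
      γ * r                            ∎

    γ≢0 : γ ≢ 0#
    γ≢0 γ≡0 = det≢0 (begin
      α * δ - β * γ        ≡⟨ cong (λ d → α * d - β * γ) δ≡γr ⟩
      α * (γ * r) - β * γ  ≡⟨ solve 4 (λ α β γ r → α :* (γ :* r) :- β :* γ := γ :* (α :* r :- β))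
                                refl α β γ r ⟩
      γ * (α * r - β)      ≡⟨ cong (_* (α * r - β)) γ≡0 ⟩
      0# * (α * r - β)     ≡⟨ zeroˡ _ ⟩
      0#                   ∎)

    N∈′ : Pencil t′ r₀ r₁ (precompNum t α β γ (γ * r))
    N∈′ = subst (λ d → Pencil t′ r₀ r₁ (precompNum t α β γ d)) δ≡γr N∈

    D∈′ : Pencil t′ r₀ r₁ (precompDen α β γ (γ * r))
    D∈′ = subst (λ d → Pencil t′ r₀ r₁ (precompDen α β γ d)) δ≡γr D∈

    β≡ : β ≡ - (α * r + α * r)
    β≡ = shared-root-β r₁≢0 γ≢0 r₀≡rr₁ D∈′

    det′ : α * (γ * r) - - (α * r + α * r) * γ ≢ 0#
    det′ = subst₂ (λ b d → α * d - b * γ ≢ 0#) β≡ δ≡γr det≢0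

    t′≡ : t′ ≡ - (r ^ 3 + r ^ 3)
    t′≡ = shared-root-t′ det′ γ≢0 (subst (λ b → Pencil t′ r₀ r₁ (precompDen α b γ (γ * r))) β≡ D∈′)

  no-common-pencil : ∀ {t t′ α β γ δ r₀ r₁} → t ≢ 0# → α * δ - β * γ ≢ 0# →
                     Pencil t′ r₀ r₁ (precompNum t α β γ δ) → Pencil t′ r₀ r₁ (precompDen α β γ δ) → ⊥
  no-common-pencil {t} {t′} {α} {β} {γ} {δ} {r₀} {r₁} t≢0 det≢0 N∈ D∈
    -- γ * - r₀ + δ * r₁ is M at the root (-r₀ : r₁) of R = r₀ + r₁X
    with γ * - r₀ + δ * r₁ ≟ 0# | r₁ ≟ 0# | r₀ ≟ 0#
  ... | no M≢0  | _        | _        = M≢0 (common-zero⇒M≡0 t≢0 (vanishes N∈) (vanishes D∈))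
    where
    vanishes : ∀ {V} → Pencil t′ r₀ r₁ V → homogeneousEval 4 V (- r₀) r₁ ≡ 0#
    vanishes V∈ = pencil-vanishes V∈ (solve 2 (λ r₀ r₁ → r₀ :* r₁ :+ r₁ :* (:- r₀) := con 0ℤ) refl r₀ r₁)
  ... | yes M≡0 | no r₁≢0  | _        = linear-R-case det≢0 r₁≢0 M≡0 N∈ D∈
  ... | yes M≡0 | yes refl | no r₀≢0  = constant-R-case det≢0 r₀≢0 M≡0 N∈ D∈
  ... | yes _   | yes refl | yes refl = M≢0 (common-zero⇒M≡0 t≢0 (vanishes N∈) (vanishes D∈))
    where
    -- R = 0, so evaluate at the root (-β : α) of L, where M is det φ
    M≢0 : γ * - β + δ * α ≢ 0#
    M≢0 = det≢0 ∘ trans (solve 4 (λ α β γ δ → α :* δ :- β :* γ := γ :* (:- β) :+ δ :* α) refl α β γ δ)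

    vanishes : ∀ {V} → Pencil t′ 0# 0# V → homogeneousEval 4 V (- β) α ≡ 0#
    vanishes V∈ = pencil-vanishes V∈ (solve 2 (λ α β → con 0ℤ :* α :+ con 0ℤ :* (:- β) := con 0ℤ) refl α β)

proposition3p4 : (K : FiniteField) → (t t′ : FiniteField.F K) → ¬ (t ≡ FiniteField.0# K) → ¬ (t′ ≡ FiniteField.0# K) → ¬ RatFun.Equivalent K (RatFun.fA K t) (RatFun.fB K t′)
proposition3p4 K t t′ t≢0 t′≢0 (ψ , φ , fB≈ψ∘f∘φ) =
  let P∈ , Q∈ = fB≈ᵣ⇒pencil K (postcomp ψ f∘φ) t′≢0 (λ _ → refl) (λ _ → refl) fB≈ψ∘f∘φ
      N∈ , D∈ = span-postcomp⁻¹ K ψ f∘φ P∈ Q∈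
  in  no-common-pencil K t≢0 (det≢0 φ) N∈ D∈
  where
  open RatFun K using (Rat; precomp; postcomp; fA; det≢0)
  f∘φ : Rat
  f∘φ = precomp (fA t) φ
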